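{- Let $n$ be an even positive integer. The digraph $\vec{C}_n \wr \vec{C}_3$ does not admit a type-I 2-factorization that is a hamiltonian decomposition (i.e. in which every 2-factor is a directed hamiltonian cycle).
   Context: Let $V(\vec{C}_n)=\mathbb{Z}_n$ with arcs $(i,i+1)$ and $V(\vec{C}_3)=\mathbb{Z}_3$ with arcs $(j,j+1)$; $\vec{C}_n\wr\vec{C}_3$ has vertex set $\mathbb{Z}_n\times\mathbb{Z}_3$, with $((g_1,h_1),(g_2,h_2))$ an arc iff $g_2=g_1+1$, or $g_1=g_2$ and $h_2=h_1+1$. Write $i_j$ for $(i,j)$ and $C^i_3$ for the directed 3-cycle $i_0\,i_1\,i_2\,i_0$. A directed 2-factor is a spanning subdigraph that is a vertex-disjoint union of directed cycles; it is of type $k$ if it contains exactly $k$ arcs of $C^i_3$ for every $i\in\mathbb{Z}_n$. A type-I 2-factorization of $\vec{C}_n\wr\vec{C}_3$ is a partition of its arc set into four directed 2-factors, three of type 1 and one of type 0. -}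

module Defs where

open import Data.Nat using (ℕ; zero; suc; NonZero)
open import Data.Nat.DivMod using (_%_; m%n<n)
open import Data.Fin using (Fin; toℕ; fromℕ<)
open import Data.Fin.Properties using (_≟_)
open import Data.Product using (Σ; ∃; ∃!; _×_; _,_; proj₁; proj₂)
open import Data.Product.Properties using (≡-dec)
open import Data.Sum using (_⊎_)
open import Data.List using (List; length; filter)
open import Data.List.Base using (allFin)
open import Function.Definitions using (Bijective)
open import Relation.Binary.PropositionalEquality using (_≡_; _≢_)
open import Relation.Binary.Definitions using (DecidableEquality)

incr : ∀ {n} .{{_ : NonZero n}} → Fin n → Fin n
incr {n} i = fromℕ< (m%n<n (suc (toℕ i)) n)

-- vertex set ℤ_n × ℤ_3 of C⃗_n ≀ C⃗_3 ; vertex i_j is (i , j)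
Vertex : (n : ℕ) → Set
Vertex n = Fin n × Fin 3

_≟V_ : ∀ {n} → DecidableEquality (Vertex n)
_≟V_ = ≡-dec _≟_ _≟_

IsArc : ∀ n .{{_ : NonZero n}} → Vertex n → Vertex n → Set
IsArc n (g₁ , h₁) (g₂ , h₂) = (g₂ ≡ incr g₁) ⊎ ((g₁ ≡ g₂) × (h₂ ≡ incr h₁))

-- A directed 2-factor (spanning subdigraph in which every vertex has
-- in- and out-degree exactly 1) is given by its successor permutation σ:
-- its arcs are exactly the pairs (u , σ u).
IsDirected2Factor : ∀ n .{{_ : NonZero n}} → (Vertex n → Vertex n) → Set
IsDirected2Factor n σ = Bijective _≡_ _≡_ σ × (∀ u → IsArc n u (σ u))

iter : ∀ {A : Set} → (A → A) → ℕ → A → A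
iter f zero x = x
iter f (suc k) x = f (iter f k x)

IsHamiltonianCycle : ∀ n → (Vertex n → Vertex n) → Set
IsHamiltonianCycle n σ = ∀ u v → ∃ λ k → iter σ k u ≡ v

arcsOfC3In : ∀ n → (Vertex n → Vertex n) → Fin n → ℕ
arcsOfC3In n σ i =
  length (filter (λ j → σ (i , j) ≟V (i , incr j)) (allFin 3))

HasType : ∀ n → ℕ → (Vertex n → Vertex n) → Set
HasType n k σ = ∀ i → arcsOfC3In n σ i ≡ k

IsTypeI2Factorization : ∀ n .{{_ : NonZero n}} → (Fin 4 → Vertex n → Vertex n) → Set
IsTypeI2Factorization n σ =
  (∀ c → IsDirected2Factor n (σ c))
  × (∀ u v → IsArc n u v → ∃! _≡_ (λ c → σ c u ≡ v))
  × (∃ λ c₀ → HasType n 0 (σ c₀) × (∀ c → c ≢ c₀ → HasType n 1 (σ c)))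

HamiltonianTypeI2Factorization : ∀ n .{{_ : NonZero n}} → Set
HamiltonianTypeI2Factorization n =
  Σ (Fin 4 → Vertex n → Vertex n) λ σ →
    IsTypeI2Factorization n σ × (∀ c → IsHamiltonianCycle n (σ c))

-- Between layers i and i + 1 each factor acts by a permutation of ℤ₃: the type-0 factor by
-- P i, and a type-1 factor with vertical arc a i → a i + 1 by the map Q i that agrees with it
-- off a i and sends a i to a (i + 1) + 1.  A permutation of ℤ₃ is a rotation (even) or a
-- reflection (odd).  If the type-0 factor is hamiltonian, the product of the P i is a
-- 3-cycle, so evenly many P i are odd.  If a type-1 factor is hamiltonian, it must swap the
-- two classes {a i, a i + 1} and {a i + 2} of a layer an odd number of times around the
-- cycle, and it swaps them between i and i + 1 exactly when Q i is even.  But the four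
-- factors split the nine arcs between two layers, and a finite check shows that then P i is
-- odd exactly when an odd number of the three Q i are even.  Summing over the layers gives
-- 0 ≡ 1 + 1 + 1 (mod 2).

module Submission where

open import Defs
open import Algebra.Bundles using (CommutativeRing)
open import Data.Bool using (Bool; true; false; not; _xor_; if_then_else_)
open import Data.Bool.Properties using (xor-assoc; xor-comm; xor-∧-commutativeRing; ¬-not)
  renaming (_≟_ to _≟ᵇ_)
open import Data.Fin using (Fin; zero; suc; toℕ; punchIn)
open import Data.Fin.Patterns using (0F; 1F; 2F)
open import Data.Fin.Properties
  using (_≟_; all?; any?; toℕ-injective; toℕ-fromℕ<; toℕ<n; punchIn-injective; punchInᵢ≢i)
open import Data.List using ([]; _∷_; length; filter; allFin)
open import Data.List.Membership.Propositional using (_∈_; lose)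
open import Data.List.Membership.Propositional.Properties using (∈-filter⁺; ∈-filter⁻; ∈-allFin)
open import Data.List.Properties using (filter-some)
open import Data.List.Relation.Unary.Any using (here)
open import Data.Nat using (ℕ; zero; suc; _+_; NonZero; _<_; z<s; s<s)
open import Data.Nat.DivMod using (_mod_; _%_; m<n⇒m%n≡m; n%n≡0)
open import Data.Nat.Divisibility using (_∣_; ∣1⇒≡1)
open import Data.Nat.Properties using (n≮0; m≤n⇒m<n∨m≡n; 1+n≢n; <-irrefl)
open import Data.Product using (∃; _×_; _,_; proj₁; proj₂; map₂)
open import Data.Sum using (_⊎_; inj₁; inj₂)
open import Data.Unit using (tt)
open import Function using (_∘_; id; case_of_)
open import Function.Construct.Composition using (injective)
open import Function.Definitions using (Injective)
open import Relation.Binary.PropositionalEquality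
open ≡-Reasoning
open import Relation.Nullary using (¬_; Dec; yes; no; does; contradiction)
open import Relation.Nullary.Decidable using (toWitness; map′; _→-dec_; ¬?; dec-true; dec-false)
open import Relation.Unary using (Decidable)

open import Algebra.Properties.CommutativeSemigroup
  (CommutativeRing.+-commutativeSemigroup xor-∧-commutativeRing) using (interchange)

Map₃ : Set
Map₃ = Fin 3 → Fin 3

IsPerm : Map₃ → Set
IsPerm = Injective _≡_ _≡_

-- A permutation of ℤ₃ is a rotation j ↦ j + c (even) or a reflection j ↦ c − j (odd),
-- and the images of 0 and 1 already tell which.
isEven : Map₃ → Bool
isEven f = does (f 1F ≟ incr (f 0F))

isOdd : Map₃ → Bool
isOdd f = not (isEven f)

isOdd-cong : ∀ {f g} → f ≗ g → isOdd f ≡ isOdd g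
isOdd-cong f≗g = cong₂ (λ x y → not (does (y ≟ incr x))) (f≗g 0F) (f≗g 1F)

DisjointOff : Fin 3 → Map₃ → Fin 3 → Map₃ → Set
DisjointOff a q b r = ∀ j → j ≢ a → j ≢ b → q j ≢ r j

table : Fin 3 → Fin 3 → Fin 3 → Map₃
table x y z 0F = x
table x y z 1F = y
table x y z 2F = z

toTable : Map₃ → Map₃
toTable f = table (f 0F) (f 1F) (f 2F)

toTable-≗ : ∀ f → toTable f ≗ f
toTable-≗ f 0F = refl
toTable-≗ f 1F = refl
toTable-≗ f 2F = refl

-- Q for all six permutations of ℤ₃, given by their tables of values, so that it can be decided
-- by evaluation; a record rather than a definition so that Q can be inferred from AllPerms Q.
record AllPerms (Q : Map₃ → Set) : Set where
  constructor allPerms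
  field
    onTables : ∀ x y → x ≢ y → ∀ z → x ≢ z → y ≢ z → Q (table x y z)

allPerms? : {Q : Map₃ → Set} → (∀ f → Dec (Q f)) → Dec (AllPerms Q)
allPerms? Q? = map′ allPerms AllPerms.onTables
  (all? λ x → all? λ y → ¬? (x ≟ y) →-dec
   all? λ z → ¬? (x ≟ z) →-dec ¬? (y ≟ z) →-dec Q? (table x y z))

atPerm : ∀ {Q f} → AllPerms Q → IsPerm f → Q (toTable f)
atPerm (allPerms h) f-inj =
  h _ _ (λ e → case f-inj e of λ ()) _ (λ e → case f-inj e of λ ()) (λ e → case f-inj e of λ ())

disjointOff? : ∀ a q b r → Dec (DisjointOff a q b r)
disjointOff? a q b r = all? λ j → ¬? (j ≟ a) →-dec ¬? (j ≟ b) →-dec ¬? (q j ≟ r j)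

DisjointOff-toTable : ∀ {a q b r} → DisjointOff a q b r → DisjointOff a (toTable q) b (toTable r)
DisjointOff-toTable {q = q} {r = r} d j j≢a j≢b e =
  d j j≢a j≢b (trans (sym (toTable-≗ q j)) (trans e (toTable-≗ r j)))

isOdd-∘ : ∀ {f g} → IsPerm f → IsPerm g → isOdd (g ∘ f) ≡ isOdd g xor isOdd f
isOdd-∘ {f} {g} f-inj g-inj =
  trans (isOdd-cong tabulated) (atPerm (atPerm check f-inj) g-inj)
  where
  tabulated : g ∘ f ≗ toTable g ∘ toTable f
  tabulated j = trans (sym (toTable-≗ g (f j))) (cong (toTable g) (sym (toTable-≗ f j)))
  check : AllPerms λ f → AllPerms λ g → isOdd (g ∘ f) ≡ isOdd g xor isOdd f
  check = toWitness {a? = allPerms? λ f → allPerms? λ g → isOdd (g ∘ f) ≟ᵇ isOdd g xor isOdd f} tt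

isOdd⇒fixedPoint : ∀ {f} → IsPerm f → isOdd f ≡ true → ∃ λ j → f j ≡ j
isOdd⇒fixedPoint {f} f-inj odd =
  map₂ (λ {j} → trans (sym (toTable-≗ f j))) (atPerm check f-inj odd)
  where
  check : AllPerms λ f → isOdd f ≡ true → ∃ λ j → f j ≡ j
  check = toWitness {a? = allPerms? λ f → (isOdd f ≟ᵇ true) →-dec any? λ j → f j ≟ j} tt

isEven-detects-successor : ∀ {f a j} → IsPerm f → j ≢ a →
                           isEven f xor does (f j ≟ incr (f a)) ≡ does (j ≟ incr (incr a))
isEven-detects-successor {f} {a} {j} f-inj j≢a =
  trans (cong₂ (λ x y → isEven f xor does (x ≟ incr y)) (sym (toTable-≗ f j)) (sym (toTable-≗ f a)))
        (atPerm check f-inj a j j≢a)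
  where
  check : AllPerms λ f → ∀ a j → j ≢ a →
          isEven f xor does (f j ≟ incr (f a)) ≡ does (j ≟ incr (incr a))
  check = toWitness {a? = allPerms? λ f → all? λ a → all? λ j → ¬? (j ≟ a) →-dec
                      (isEven f xor does (f j ≟ incr (f a)) ≟ᵇ does (j ≟ incr (incr a)))} tt

layer-parity-check : AllPerms λ p →
  ∀ a₀ → AllPerms λ q₀ → DisjointOff a₀ q₀ a₀ p →
  ∀ a₁ → AllPerms λ q₁ → DisjointOff a₁ q₁ a₁ p → DisjointOff a₀ q₀ a₁ q₁ →
  ∀ a₂ → AllPerms λ q₂ →
    DisjointOff a₂ q₂ a₂ p → DisjointOff a₀ q₀ a₂ q₂ → DisjointOff a₁ q₁ a₂ q₂ →
  isOdd p ≡ isEven q₀ xor isEven q₁ xor isEven q₂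
layer-parity-check = toWitness {a? =
  allPerms? λ p →
  all? λ a₀ → allPerms? λ q₀ → disjointOff? a₀ q₀ a₀ p →-dec
  all? λ a₁ → allPerms? λ q₁ → disjointOff? a₁ q₁ a₁ p →-dec disjointOff? a₀ q₀ a₁ q₁ →-dec
  all? λ a₂ → allPerms? λ q₂ →
    disjointOff? a₂ q₂ a₂ p →-dec disjointOff? a₀ q₀ a₂ q₂ →-dec disjointOff? a₁ q₁ a₂ q₂ →-dec
  (isOdd p ≟ᵇ isEven q₀ xor isEven q₁ xor isEven q₂)} tt

layer-parity : ∀ {p q₀ q₁ q₂ a₀ a₁ a₂} → IsPerm p → IsPerm q₀ → IsPerm q₁ → IsPerm q₂ →
               DisjointOff a₀ q₀ a₀ p → DisjointOff a₁ q₁ a₁ p → DisjointOff a₂ q₂ a₂ p →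
               DisjointOff a₀ q₀ a₁ q₁ → DisjointOff a₀ q₀ a₂ q₂ → DisjointOff a₁ q₁ a₂ q₂ →
               isOdd p ≡ isEven q₀ xor isEven q₁ xor isEven q₂
layer-parity {a₀ = a₀} {a₁} {a₂} p-inj q₀-inj q₁-inj q₂-inj d₀ d₁ d₂ d₀₁ d₀₂ d₁₂ =
  atPerm (atPerm (atPerm (atPerm layer-parity-check p-inj
    a₀) q₀-inj (DisjointOff-toTable d₀)
    a₁) q₁-inj (DisjointOff-toTable d₁) (DisjointOff-toTable d₀₁)
    a₂) q₂-inj (DisjointOff-toTable d₂) (DisjointOff-toTable d₀₂) (DisjointOff-toTable d₁₂)

xorSum : (ℕ → Bool) → ℕ → Bool
xorSum f zero = false
xorSum f (suc k) = xorSum f k xor f k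

xorSum-cong : ∀ {f g} → (∀ k → f k ≡ g k) → ∀ n → xorSum f n ≡ xorSum g n
xorSum-cong f≗g zero = refl
xorSum-cong f≗g (suc n) = cong₂ _xor_ (xorSum-cong f≗g n) (f≗g n)

xorSum-xor : ∀ f g n → xorSum (λ k → f k xor g k) n ≡ xorSum f n xor xorSum g n
xorSum-xor f g zero = refl
xorSum-xor f g (suc n) =
  trans (cong (_xor (f n xor g n)) (xorSum-xor f g n))
        (interchange (xorSum f n) (xorSum g n) (f n) (g n))

does-≟-injective : ∀ {m k} {f : Fin m → Fin k} {x y} → Injective _≡_ _≡_ f →
                   does (f x ≟ f y) ≡ does (x ≟ y)
does-≟-injective {f = f} {x} {y} f-inj with x ≟ y
... | yes refl = dec-true (f x ≟ f x) refl
... | no x≢y = dec-false (f x ≟ f y) (x≢y ∘ f-inj)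

injective-off-point : ∀ {m k} {f : Fin m → Fin k} a →
                      (∀ {x y} → x ≢ a → y ≢ a → f x ≡ f y → x ≡ y) →
                      (∀ {x} → x ≢ a → f x ≢ f a) → Injective _≡_ _≡_ f
injective-off-point a inj-off avoids {x} {y} e with x ≟ a | y ≟ a
... | yes refl | yes refl = refl
... | yes refl | no y≢a = contradiction (sym e) (avoids y≢a)
... | no x≢a | yes refl = contradiction e (avoids x≢a)
... | no x≢a | no y≢a = inj-off x≢a y≢a e

iter-invariant : ∀ {A B : Set} {f : A → A} (ℓ : A → B) → (∀ x → ℓ (f x) ≡ ℓ x) →
                 ∀ k x → ℓ (iter f k x) ≡ ℓ x
iter-invariant ℓ inv zero x = refl
iter-invariant ℓ inv (suc k) x = trans (inv _) (iter-invariant ℓ inv k x)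

invariant⇒¬hamiltonian : ∀ {n B} {σ : Vertex n → Vertex n} (ℓ : Vertex n → B) →
                         (∀ u → ℓ (σ u) ≡ ℓ u) → ∀ {u v} → ℓ u ≢ ℓ v → ¬ IsHamiltonianCycle n σ
invariant⇒¬hamiltonian ℓ inv {u} {v} ℓu≢ℓv ham =
  let k , reaches = ham u v in ℓu≢ℓv (trans (sym (iter-invariant ℓ inv k u)) (cong ℓ reaches))

module _ {A : Set} {P : A → Set} (P? : Decidable P) where

  count≡0⇒¬ : ∀ {xs x} → length (filter P? xs) ≡ 0 → x ∈ xs → ¬ P x
  count≡0⇒¬ none x∈xs Px = n≮0 (subst (0 <_) none (filter-some P? (lose x∈xs Px)))

  count≡1⇒unique : ∀ {xs} → length (filter P? xs) ≡ 1 →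
                   ∃ λ x → P x × (∀ {y} → y ∈ xs → P y → y ≡ x)
  count≡1⇒unique {xs} one with filter P? xs in eq
  ... | x ∷ [] = x , proj₂ (∈-filter⁻ P? {xs = xs} (subst (x ∈_) (sym eq) (here refl))) , unique
    where
    unique : ∀ {y} → y ∈ xs → P y → y ≡ x
    unique y∈xs Py with subst (_ ∈_) eq (∈-filter⁺ P? y∈xs Py)
    ... | here y≡x = y≡x

module _ {n} .{{_ : NonZero n}} where

  incr-cases : (i : Fin n) → toℕ (incr i) ≡ suc (toℕ i) ⊎ (toℕ (incr i) ≡ 0 × suc (toℕ i) ≡ n)
  incr-cases i with m≤n⇒m<n∨m≡n (toℕ<n i)
  ... | inj₁ i+1<n = inj₁ (trans (toℕ-fromℕ< _) (m<n⇒m%n≡m i+1<n))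
  ... | inj₂ i+1≡n = inj₂ (trans (toℕ-fromℕ< _) (trans (cong (_% n) i+1≡n) (n%n≡0 n)) , i+1≡n)

  incr-≢ : 1 < n → (i : Fin n) → incr i ≢ i
  incr-≢ 1<n i incr-i≡i with incr-cases i
  ... | inj₁ next = 1+n≢n (trans (sym next) (cong toℕ incr-i≡i))
  ... | inj₂ (wrap , i+1≡n) = <-irrefl refl (subst (1 <_) n≡1 1<n)
    where
    n≡1 : n ≡ 1
    n≡1 = trans (sym i+1≡n) (cong suc (trans (cong toℕ (sym incr-i≡i)) wrap))

  toℕ-mod : (i : Fin n) → toℕ i mod n ≡ i
  toℕ-mod i = toℕ-injective (trans (toℕ-fromℕ< _) (m<n⇒m%n≡m (toℕ<n i)))

  periodic-step : ∀ {A : Set} (step : Fin n → A → A) (z : ℕ → A) →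
                  (∀ k → z (suc k) ≡ step (k mod n) (z k)) → z n ≡ z 0 →
                  ∀ i → z (toℕ (incr i)) ≡ step i (z (toℕ i))
  periodic-step step z z-step z-period i = begin
    z (toℕ (incr i))                ≡⟨ after-incr ⟩
    z (suc (toℕ i))                 ≡⟨ z-step (toℕ i) ⟩
    step (toℕ i mod n) (z (toℕ i))  ≡⟨ cong (λ j → step j (z (toℕ i))) (toℕ-mod i) ⟩
    step i (z (toℕ i))              ∎
    where
    after-incr : z (toℕ (incr i)) ≡ z (suc (toℕ i))
    after-incr with incr-cases i
    ... | inj₁ next = cong z next
    ... | inj₂ (wrap , i+1≡n) = trans (cong z wrap) (trans (sym z-period) (cong z (sym i+1≡n)))

incr²-≢ : (j : Fin 3) → incr (incr j) ≢ j
incr²-≢ 0F ()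
incr²-≢ 1F ()
incr²-≢ 2F ()

module TypeIFactorization {m : ℕ} (σ : Fin 4 → Vertex (2 + m) → Vertex (2 + m))
                          (fac : IsTypeI2Factorization (2 + m) σ) where

  private
    n : ℕ
    n = 2 + m

    1<n : 1 < n
    1<n = s<s z<s

  c₀ : Fin 4
  c₀ = proj₁ (proj₂ (proj₂ fac))

  colour : Fin 3 → Fin 4
  colour = punchIn c₀

  σ-injective : ∀ c {u v} → σ c u ≡ σ c v → u ≡ v
  σ-injective c = proj₁ (proj₁ (proj₁ fac c))

  σ-colour-unique : ∀ {c c′} u → σ c u ≡ σ c′ u → c ≡ c′
  σ-colour-unique {c} {c′} u e =
    let _ , _ , unique = proj₁ (proj₂ fac) u (σ c u) (proj₂ (proj₁ fac c) u)
    in trans (sym (unique refl)) (unique (sym e))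

  leaves-layer : ∀ c i j → σ c (i , j) ≢ (i , incr j) → σ c (i , j) ≡ (incr i , proj₂ (σ c (i , j)))
  leaves-layer c i j not-vertical with proj₂ (proj₁ fac c) (i , j)
  ... | inj₁ next = cong (_, _) next
  ... | inj₂ (same , up) = contradiction (cong₂ _,_ (sym same) up) not-vertical

  P : Fin n → Map₃
  P i j = proj₂ (σ c₀ (i , j))

  σ₀-step : ∀ i j → σ c₀ (i , j) ≡ (incr i , P i j)
  σ₀-step i j =
    leaves-layer c₀ i j (count≡0⇒¬ (λ j → σ c₀ (i , j) ≟V (i , incr j)) (type₀ i) (∈-allFin j))
    where
    type₀ : HasType n 0 (σ c₀)
    type₀ = proj₁ (proj₂ (proj₂ (proj₂ fac)))

  P-perm : ∀ i → IsPerm (P i)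
  P-perm i {x} {y} e =
    cong proj₂ (σ-injective c₀
      (trans (σ₀-step i x) (trans (cong (incr i ,_) e) (sym (σ₀-step i y)))))

  vertical-arc : ∀ t i → ∃ λ a → σ (colour t) (i , a) ≡ (i , incr a) ×
                   (∀ {j} → j ∈ allFin 3 → σ (colour t) (i , j) ≡ (i , incr j) → j ≡ a)
  vertical-arc t i =
    count≡1⇒unique (λ j → σ (colour t) (i , j) ≟V (i , incr j)) (type₁ (colour t) (punchInᵢ≢i c₀ t) i)
    where
    type₁ : ∀ c → c ≢ c₀ → HasType n 1 (σ c)
    type₁ = proj₂ (proj₂ (proj₂ (proj₂ fac)))

  opaque
    a : Fin 3 → Fin n → Fin 3
    a t i = proj₁ (vertical-arc t i)

    σₜ-vertical : ∀ t i → σ (colour t) (i , a t i) ≡ (i , incr (a t i))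
    σₜ-vertical t i = proj₁ (proj₂ (vertical-arc t i))

    σₜ-vertical-unique : ∀ {t i j} → σ (colour t) (i , j) ≡ (i , incr j) → j ≡ a t i
    σₜ-vertical-unique {t} {i} {j} = proj₂ (proj₂ (vertical-arc t i)) (∈-allFin j)

  -- The arc leaving a t i stays in layer i; Q t i sends a t i instead to the head of the
  -- vertical arc of the next layer, which is the only value the other two rows miss.
  Q : Fin 3 → Fin n → Map₃
  Q t i j = if does (j ≟ a t i) then incr (a t (incr i)) else proj₂ (σ (colour t) (i , j))

  Q-at-a : ∀ t i → Q t i (a t i) ≡ incr (a t (incr i))
  Q-at-a t i = cong (λ b → if b then incr (a t (incr i)) else proj₂ (σ (colour t) (i , a t i)))
                    (dec-true (a t i ≟ a t i) refl)

  σₜ-step : ∀ {t i j} → j ≢ a t i → σ (colour t) (i , j) ≡ (incr i , Q t i j)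
  σₜ-step {t} {i} {j} j≢a =
    trans (leaves-layer (colour t) i j (j≢a ∘ σₜ-vertical-unique))
          (cong (λ b → incr i , (if b then incr (a t (incr i)) else proj₂ (σ (colour t) (i , j))))
                (sym (dec-false (j ≟ a t i) j≢a)))

  Q-perm : ∀ t i → IsPerm (Q t i)
  Q-perm t i = injective-off-point (a t i) inj-off avoids
    where
    inj-off : ∀ {x y} → x ≢ a t i → y ≢ a t i → Q t i x ≡ Q t i y → x ≡ y
    inj-off x≢a y≢a e = cong proj₂ (σ-injective (colour t)
      (trans (σₜ-step x≢a) (trans (cong (incr i ,_) e) (sym (σₜ-step y≢a)))))
    avoids : ∀ {x} → x ≢ a t i → Q t i x ≢ Q t i (a t i)
    avoids x≢a e = incr-≢ 1<n i (sym (cong proj₁ (σ-injective (colour t)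
      (trans (σₜ-step x≢a)
             (trans (cong (incr i ,_) (trans e (Q-at-a t i))) (sym (σₜ-vertical t (incr i))))))))

  Q-disjoint-P : ∀ t i → DisjointOff (a t i) (Q t i) (a t i) (P i)
  Q-disjoint-P t i j j≢a _ e = punchInᵢ≢i c₀ t
    (σ-colour-unique (i , j) (trans (σₜ-step j≢a) (trans (cong (incr i ,_) e) (sym (σ₀-step i j)))))

  Q-disjoint-Q : ∀ {t u} → t ≢ u → ∀ i → DisjointOff (a t i) (Q t i) (a u i) (Q u i)
  Q-disjoint-Q t≢u i j j≢a j≢b e = t≢u (punchIn-injective c₀ _ _
    (σ-colour-unique (i , j)
      (trans (σₜ-step j≢a) (trans (cong (incr i ,_) e) (sym (σₜ-step j≢b))))))

  layer-parity-at : ∀ i → isOdd (P i) ≡ isEven (Q 0F i) xor isEven (Q 1F i) xor isEven (Q 2F i)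
  layer-parity-at i =
    layer-parity (P-perm i) (Q-perm 0F i) (Q-perm 1F i) (Q-perm 2F i)
                 (Q-disjoint-P 0F i) (Q-disjoint-P 1F i) (Q-disjoint-P 2F i)
                 (Q-disjoint-Q (λ ()) i) (Q-disjoint-Q (λ ()) i) (Q-disjoint-Q (λ ()) i)

  P* : ℕ → Map₃
  P* zero = id
  P* (suc k) = P (k mod n) ∘ P* k

  P*-perm : ∀ k → IsPerm (P* k)
  P*-perm zero = id
  P*-perm (suc k) = injective _≡_ _≡_ _≡_ (P*-perm k) (P-perm (k mod n))

  reflections : ℕ → Bool
  reflections = xorSum (λ k → isOdd (P (k mod n)))

  isOdd-P* : ∀ k → isOdd (P* k) ≡ reflections k
  isOdd-P* zero = refl
  isOdd-P* (suc k) = begin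
    isOdd (P (k mod n) ∘ P* k)             ≡⟨ isOdd-∘ (P*-perm k) (P-perm (k mod n)) ⟩
    isOdd (P (k mod n)) xor isOdd (P* k)   ≡⟨ xor-comm (isOdd (P (k mod n))) (isOdd (P* k)) ⟩
    isOdd (P* k) xor isOdd (P (k mod n))   ≡⟨ cong (_xor isOdd (P (k mod n))) (isOdd-P* k) ⟩
    reflections (suc k)                    ∎

  fixedPoint⇒¬hamiltonian : ∀ {j₀} → P* n j₀ ≡ j₀ → ¬ IsHamiltonianCycle n (σ c₀)
  fixedPoint⇒¬hamiltonian {j₀} fixed =
    invariant⇒¬hamiltonian ℓ ℓ-invariant {zero , j₀} {zero , incr j₀} ℓ-separates
    where
    ℓ : Vertex n → Bool
    ℓ (i , j) = does (j ≟ P* (toℕ i) j₀)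

    orbit-step : ∀ i → P* (toℕ (incr i)) j₀ ≡ P i (P* (toℕ i) j₀)
    orbit-step = periodic-step P (λ k → P* k j₀) (λ k → refl) fixed

    ℓ-invariant : ∀ u → ℓ (σ c₀ u) ≡ ℓ u
    ℓ-invariant (i , j) = begin
      ℓ (σ c₀ (i , j))                       ≡⟨ cong ℓ (σ₀-step i j) ⟩
      does (P i j ≟ P* (toℕ (incr i)) j₀)    ≡⟨ cong (λ y → does (P i j ≟ y)) (orbit-step i) ⟩
      does (P i j ≟ P i (P* (toℕ i) j₀))     ≡⟨ does-≟-injective (P-perm i) ⟩
      ℓ (i , j)                              ∎

    ℓ-separates : ℓ (zero , j₀) ≢ ℓ (zero , incr j₀)
    ℓ-separates e = case trans (sym (dec-true (j₀ ≟ j₀) refl))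
                               (trans e (dec-false (incr j₀ ≟ j₀) (incr-≢ (s<s z<s) j₀))) of λ ()

  hamiltonian⇒reflections-even : IsHamiltonianCycle n (σ c₀) → reflections n ≡ false
  hamiltonian⇒reflections-even ham = ¬-not λ odd →
    fixedPoint⇒¬hamiltonian (proj₂ (isOdd⇒fixedPoint (P*-perm n) (trans (isOdd-P* n) odd))) ham

  swaps : Fin 3 → ℕ → Bool
  swaps t = xorSum (λ k → isEven (Q t (k mod n)))

  -- ℓ marks the class {a t i + 2} of layer i, flipped by the number of swaps before layer i.
  swaps-even⇒¬hamiltonian : ∀ t → swaps t n ≡ false → ¬ IsHamiltonianCycle n (σ (colour t))
  swaps-even⇒¬hamiltonian t even =
    invariant⇒¬hamiltonian ℓ ℓ-invariant
                           {zero , a t zero} {zero , incr (incr (a t zero))} ℓ-separates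
    where
    apex : Fin n → Fin 3 → Bool
    apex i j = does (j ≟ incr (incr (a t i)))

    X : Fin n → Bool
    X i = swaps t (toℕ i)

    ℓ : Vertex n → Bool
    ℓ (i , j) = X i xor apex i j

    X-step : ∀ i → X (incr i) ≡ X i xor isEven (Q t i)
    X-step = periodic-step (λ i b → b xor isEven (Q t i)) (swaps t) (λ k → refl) even

    ℓ-vertical : ∀ i → ℓ (σ (colour t) (i , a t i)) ≡ ℓ (i , a t i)
    ℓ-vertical i = begin
      ℓ (σ (colour t) (i , b))
        ≡⟨ cong ℓ (σₜ-vertical t i) ⟩
      X i xor apex i (incr b)
        ≡⟨ cong (X i xor_) (dec-false (incr b ≟ incr (incr b)) (incr-≢ (s<s z<s) (incr b) ∘ sym)) ⟩
      X i xor false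
        ≡⟨ cong (X i xor_) (sym (dec-false (b ≟ incr (incr b)) (incr²-≢ b ∘ sym))) ⟩
      ℓ (i , b)
        ∎
      where
      b : Fin 3
      b = a t i

    ℓ-crossing : ∀ {i j} → j ≢ a t i → ℓ (σ (colour t) (i , j)) ≡ ℓ (i , j)
    ℓ-crossing {i} {j} j≢a = begin
      ℓ (σ (colour t) (i , j))
        ≡⟨ cong ℓ (σₜ-step j≢a) ⟩
      X (incr i) xor apex (incr i) (Q t i j)
        ≡⟨ cong (_xor apex (incr i) (Q t i j)) (X-step i) ⟩
      (X i xor isEven (Q t i)) xor apex (incr i) (Q t i j)
        ≡⟨ xor-assoc (X i) (isEven (Q t i)) (apex (incr i) (Q t i j)) ⟩
      X i xor (isEven (Q t i) xor apex (incr i) (Q t i j))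
        ≡⟨ cong (X i xor_) parity-decides-apex ⟩
      ℓ (i , j)
        ∎
      where
      parity-decides-apex : isEven (Q t i) xor apex (incr i) (Q t i j) ≡ apex i j
      parity-decides-apex =
        trans (cong (λ h → isEven (Q t i) xor does (Q t i j ≟ incr h)) (sym (Q-at-a t i)))
              (isEven-detects-successor (Q-perm t i) j≢a)

    ℓ-invariant : ∀ u → ℓ (σ (colour t) u) ≡ ℓ u
    ℓ-invariant (i , j) with j ≟ a t i
    ... | yes refl = ℓ-vertical i
    ... | no j≢a = ℓ-crossing j≢a

    ℓ-separates : ℓ (zero , a t zero) ≢ ℓ (zero , incr (incr (a t zero)))
    ℓ-separates e = case trans (sym (dec-false (b ≟ incr (incr b)) (incr²-≢ b ∘ sym)))
                               (trans e (dec-true (incr (incr b) ≟ incr (incr b)) refl)) of λ ()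
      where
      b : Fin 3
      b = a t zero

  hamiltonian⇒swaps-odd : ∀ t → IsHamiltonianCycle n (σ (colour t)) → swaps t n ≡ true
  hamiltonian⇒swaps-odd t ham = ¬-not λ even → swaps-even⇒¬hamiltonian t even ham

  ¬hamiltonian : ¬ (∀ c → IsHamiltonianCycle n (σ c))
  ¬hamiltonian ham = case parity of λ ()
    where
    parity : false ≡ true
    parity = begin
      false
        ≡⟨ sym (hamiltonian⇒reflections-even (ham c₀)) ⟩
      reflections n
        ≡⟨ xorSum-cong (λ k → layer-parity-at (k mod n)) n ⟩
      xorSum (λ k → isEven (Q 0F (k mod n)) xor isEven (Q 1F (k mod n)) xor isEven (Q 2F (k mod n))) n
        ≡⟨ xorSum-xor _ _ n ⟩
      swaps 0F n xor xorSum (λ k → isEven (Q 1F (k mod n)) xor isEven (Q 2F (k mod n))) n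
        ≡⟨ cong (swaps 0F n xor_) (xorSum-xor _ _ n) ⟩
      swaps 0F n xor swaps 1F n xor swaps 2F n
        ≡⟨ cong₂ _xor_ (odd 0F) (cong₂ _xor_ (odd 1F) (odd 2F)) ⟩
      true
        ∎
      where
      odd : ∀ t → swaps t n ≡ true
      odd t = hamiltonian⇒swaps-odd t (ham (colour t))

-- The argument works for every n ≥ 2; evenness of n is only used to exclude n = 1.
proposition6p23 : (m : ℕ) → 2 ∣ suc m → ¬ HamiltonianTypeI2Factorization (suc m)
proposition6p23 zero 2∣1 = case ∣1⇒≡1 2∣1 of λ ()
proposition6p23 (suc m) _ (σ , fac , ham) = TypeIFactorization.¬hamiltonian σ fac ham
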